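{- Let $g=\frac{\sqrt{5}-1}{2}$ and, for integers $a$ and $e=\pm 1$, let $M(a,e)=\left(\begin{matrix} a & 1 \\ e & 0\end{matrix}\right)$. Let $$\widetilde{\Gamma}=\{\sigma\in \mathrm{GL}(2,\mathbb{Z}) \mid \sigma \equiv I,\ A \text{ or } B \pmod 2\},\qquad A=\left(\begin{matrix} 0 & 1 \\ 1 & 1\end{matrix}\right),\ B=\left(\begin{matrix} 1 & 1 \\ 1 & 0\end{matrix}\right),$$ and set $$\mathcal{S}=\Big\{\sigma=\left(\begin{matrix} a & b \\ c & d\end{matrix}\right)\in\widetilde{\Gamma} \ \Big|\ 0\le d\le b,\ 1\le c\le a,\ a/b>g\Big\},$$ $$\widetilde{\mathcal{P}}=\big\{M(a_1,e_0)M(a_2,e_1)\cdots M(a_n,e_{n-1}) \mid n\ge 1,\ a_i\in 2\mathbb{N}-1,\ e_i=\pm1,\ a_i+e_i\ge 2\big\},$$ where $e_0=1$. Then $\widetilde{\mathcal{P}}=\mathcal{S}$.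
   Context: Here $\mathbb{N}=\{1,2,3,\ldots\}$, so the $a_i$ are odd positive integers; the pairs $(a_i,e_i)$ are the digits and signs of an odd continued fraction expansion $x=a_1+\cfrac{e_1}{a_2+\cfrac{e_2}{a_3+\ddots}}$, and the product $M(a_1,e_0)\cdots M(a_n,e_{n-1})$ equals $\left(\begin{matrix} p_n & p_{n-1} \\ q_n & q_{n-1}\end{matrix}\right)$ where $p_k/q_k$ are the odd continued fraction convergents ($p_0=1,q_0=0,p_1=a_1,q_1=1$, $p_k=a_kp_{k-1}+e_{k-1}p_{k-2}$, $q_k=a_kq_{k-1}+e_{k-1}q_{k-2}$). -}

module Defs where

open import Data.Nat using (ℕ)
open import Data.Integer using (ℤ; +_; -[1+_]; _+_; _-_; _*_; -_; _≤_; _<_)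
open import Data.Integer.Divisibility using (_∣_)
open import Data.List using (List; []; _∷_)
open import Data.List.Relation.Unary.All using (All)
open import Data.Product using (_×_; ∃; _,_)
open import Data.Sum using (_⊎_)
open import Relation.Binary.PropositionalEquality using (_≡_)
open import Function.Bundles using (_⇔_)

record Mat : Set where
  constructor mat
  field
    m11 m12 m21 m22 : ℤ
open Mat public

_⊗_ : Mat → Mat → Mat
mat a b c d ⊗ mat a' b' c' d' =
  mat (a * a' + b * c') (a * b' + b * d') (c * a' + d * c') (c * b' + d * d')

I : Mat
I = mat (+ 1) (+ 0) (+ 0) (+ 1)

M : ℤ → ℤ → Mat
M a e = mat a (+ 1) e (+ 0)

det : Mat → ℤ
det (mat a b c d) = a * d - b * c

InGL2 : Mat → Set
InGL2 σ = det σ ≡ + 1 ⊎ det σ ≡ -[1+ 0 ]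

_≡₂_ : ℤ → ℤ → Set
x ≡₂ y = + 2 ∣ (x - y)

_≡M₂_ : Mat → Mat → Set
σ ≡M₂ τ = (m11 σ ≡₂ m11 τ) × (m12 σ ≡₂ m12 τ) × (m21 σ ≡₂ m21 τ) × (m22 σ ≡₂ m22 τ)

Amat Bmat : Mat
Amat = mat (+ 0) (+ 1) (+ 1) (+ 1)
Bmat = mat (+ 1) (+ 1) (+ 1) (+ 0)

InΓ̃ : Mat → Set
InΓ̃ σ = InGL2 σ × (σ ≡M₂ I ⊎ σ ≡M₂ Amat ⊎ σ ≡M₂ Bmat)

-- a / b > g with g = (√5 - 1)/2, for a ≥ 1, b ≥ 0 (b = 0 read as a/b = +∞).
-- For such a, b: a/b > g ⇔ 2a + b > √5 b ⇔ (2a+b)² > 5b² (both sides ≥ 0).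
GtG : ℤ → ℤ → Set
GtG a b = + 5 * (b * b) < (+ 2 * a + b) * (+ 2 * a + b)

InS : Mat → Set
InS σ = InΓ̃ σ
      × (+ 0 ≤ m22 σ) × (m22 σ ≤ m12 σ)
      × (+ 1 ≤ m21 σ) × (m21 σ ≤ m11 σ)
      × GtG (m11 σ) (m12 σ)

-- a ∈ 2ℕ - 1 (ℕ = {1,2,...}), i.e. a odd positive
OddPos : ℤ → Set
OddPos a = ∃ λ (k : ℕ) → a ≡ + 1 + + 2 * + k

Digit : Set
Digit = ℤ × ℤ

ValidDigit : Digit → Set
ValidDigit (a , e) = OddPos a × (e ≡ + 1 ⊎ e ≡ -[1+ 0 ]) × (+ 2 ≤ a + e)

-- prodFrom e_{i-1} [(a_i,e_i),…,(a_n,e_n)] = M(a_i,e_{i-1}) M(a_{i+1},e_i) ⋯ M(a_n,e_{n-1})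
prodFrom : ℤ → List Digit → Mat
prodFrom e [] = I
prodFrom e ((a , e') ∷ ds) = M a e ⊗ prodFrom e' ds

InP : Mat → Set
InP σ = ∃ λ (d : Digit) → ∃ λ (ds : List Digit) →
          All ValidDigit (d ∷ ds) × prodFrom (+ 1) (d ∷ ds) ≡ σ

{-# OPTIONS --safe #-}
module Submission where

-- Write N x y = x² + xy − y²; since (2x + y)² − 5y² = 4 N x y, the condition a/b > g on the
-- first row (a, b) = (pₙ, pₙ₋₁) of a product reads N a b ≥ 1.
--
-- 𝒫̃ ⊆ 𝒮: multiplying on the right by M(a, e) with a, e odd keeps the determinant ±1 and cycles the
-- residue classes I → B → A → I mod 2.  It also keeps pₙ/pₙ₋₁ > g: this needs e = −1 only after
-- a digit ≥ 3, and a last digit ≥ 3 forces pₙ/pₙ₋₁ > 2 + g, whence pₙ₊₁/pₙ = a − pₙ₋₁/pₙ > g.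
-- The bounds on the second row follow by peeling digits off on the left instead.
--
-- 𝒮 ⊆ 𝒫̃: for σ = (A B; C D) ∈ 𝒮 with D ≥ 1, one step of the odd continued fraction algorithm
-- writes A/B = a + e b′/B with a odd, 0 ≤ b′ < A and B/b′ > g (and B/b′ > 2 + g when e = −1,
-- a ≥ 3 when A/B > 2 + g).  Then σ = σ′ M(a, e) with σ′ = (B b′; D e(C − aD)), and the
-- determinant, the parity class and C ≤ A put σ′ in 𝒮.  Induction on A + B ends at D = 0,
-- where det σ = ±1 and the parity class force σ = M(A, 1) with A odd.

open import Defs
open import Data.Empty using (⊥; ⊥-elim)
open import Data.Integer using (ℤ; +_; -[1+_]; _+_; _-_; _*_; -_; _≤_; +≤+; ∣_∣)
open import Data.Integer.Base using (nonNegative)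
import Data.Integer.Divisibility.Signed as Signed
open import Data.Integer.Properties
  using (≤-refl; ≤-reflexive; ≤-trans; ≤-antisym; _≤?_; ≰⇒>; i<j⇒suc[i]≤j; suc[i]≤j⇒i<j;
         i≤j⇒0≤j-i; 0≤i-j⇒j≤i; +-mono-≤; *-comm; *-zeroʳ; *-monoˡ-≤-nonNeg; abs-*; 0≤i⇒+∣i∣≡i)
open import Data.Integer.Tactic.RingSolver using (solve-∀)
open import Data.List using ([]; _∷_)
open import Data.List.Relation.Unary.All using (All; []; _∷_)
open import Data.Nat as ℕ using (zero; suc)
import Data.Nat.Divisibility as ℕ
import Data.Nat.Properties as ℕ
open import Data.Product using (_×_; ∃; _,_; proj₁; proj₂)
open import Data.Sum as Sum using (_⊎_; inj₁; inj₂)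
open import Function using (_∘_)
open import Function.Bundles using (_⇔_; mk⇔)
open import Relation.Binary.PropositionalEquality
open import Relation.Nullary using (¬_; yes; no)

-- Integer arithmetic

-- Inequalities are proved by writing j − i as a visibly nonnegative polynomial (a certificate).
≤-via : ∀ {i j} k → j - i ≡ k → + 0 ≤ k → i ≤ j
≤-via k j-i≡k 0≤k = 0≤i-j⇒j≤i (subst (+ 0 ≤_) (sym j-i≡k) 0≤k)

nonNeg≢-1 : ∀ {i} → + 0 ≤ i → i ≢ -[1+ 0 ]
nonNeg≢-1 0≤i refl with 0≤i
... | ()

nonNeg-ℕ : ∀ n → + 0 ≤ + n
nonNeg-ℕ n = +≤+ ℕ.z≤n

nonNeg-+ : ∀ {i j} → + 0 ≤ i → + 0 ≤ j → + 0 ≤ i + j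
nonNeg-+ = +-mono-≤

nonNeg-* : ∀ {i j} → + 0 ≤ i → + 0 ≤ j → + 0 ≤ i * j
nonNeg-* {i} {j} 0≤i 0≤j =
  subst (_≤ i * j) (*-zeroʳ i) (*-monoˡ-≤-nonNeg i {{nonNegative 0≤i}} 0≤j)

≰⇒1+≤ : ∀ {i j} → ¬ (i ≤ j) → + 1 + j ≤ i
≰⇒1+≤ i≰j = i<j⇒suc[i]≤j (≰⇒> i≰j)

nonNeg∧≢0⇒pos : ∀ {i} → + 0 ≤ i → i ≢ + 0 → + 1 ≤ i
nonNeg∧≢0⇒pos {+ zero}  _ i≢0 = ⊥-elim (i≢0 refl)
nonNeg∧≢0⇒pos {+ suc _} _ _   = +≤+ (ℕ.s≤s ℕ.z≤n)

Sign : ℤ → Set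
Sign e = e ≡ + 1 ⊎ e ≡ -[1+ 0 ]

Sign-* : ∀ {i j} → Sign i → Sign j → Sign (i * j)
Sign-* (inj₁ refl) (inj₁ refl) = inj₁ refl
Sign-* (inj₁ refl) (inj₂ refl) = inj₂ refl
Sign-* (inj₂ refl) (inj₁ refl) = inj₂ refl
Sign-* (inj₂ refl) (inj₂ refl) = inj₁ refl

Sign-neg : ∀ {i} → Sign i → Sign (- i)
Sign-neg (inj₁ refl) = inj₂ refl
Sign-neg (inj₂ refl) = inj₁ refl

Sign⇒i*i≡1 : ∀ {i} → Sign i → i * i ≡ + 1
Sign⇒i*i≡1 (inj₁ refl) = refl
Sign⇒i*i≡1 (inj₂ refl) = refl

Sign⇒0≤1+i : ∀ {i} → Sign i → + 0 ≤ i + + 1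
Sign⇒0≤1+i (inj₁ refl) = nonNeg-ℕ 2
Sign⇒0≤1+i (inj₂ refl) = nonNeg-ℕ 0

Sign-cancelʳ : ∀ {i j} → Sign j → Sign (i * j) → Sign i
Sign-cancelʳ {i} {j} sj sij = subst Sign i*j*j≡i (Sign-* sij sj)
  where
  i*j*j≡i : i * j * j ≡ i
  i*j*j≡i = begin
    i * j * j    ≡⟨ reassoc i j ⟩
    i * (j * j)  ≡⟨ cong (i *_) (Sign⇒i*i≡1 sj) ⟩
    i * + 1      ≡⟨ unit i ⟩
    i            ∎
    where
    open ≡-Reasoning
    reassoc : ∀ i j → i * j * j ≡ i * (j * j)
    reassoc = solve-∀
    unit : ∀ i → i * + 1 ≡ i
    unit = solve-∀

nonNeg∧Sign[i*j]⇒i≡1 : ∀ {i j} → + 0 ≤ i → Sign (i * j) → i ≡ + 1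
nonNeg∧Sign[i*j]⇒i≡1 {i} {j} 0≤i sij =
  trans (sym (0≤i⇒+∣i∣≡i 0≤i))
        (cong +_ (ℕ.m*n≡1⇒m≡1 ∣ i ∣ ∣ j ∣ (trans (sym (abs-* i j)) (∣Sign∣≡1 sij))))
  where
  ∣Sign∣≡1 : ∀ {k} → Sign k → ∣ k ∣ ≡ 1
  ∣Sign∣≡1 (inj₁ refl) = refl
  ∣Sign∣≡1 (inj₂ refl) = refl

-- Parity

infix 4 _≈₂_ _≈M₂_

data _≈₂_ (i j : ℤ) : Set where
  ≈₂-by : ∀ t → i ≡ j + t * + 2 → i ≈₂ j

≈₂⇒≡₂ : ∀ {i j} → i ≈₂ j → i ≡₂ j
≈₂⇒≡₂ {j = j} (≈₂-by t refl) = Signed.∣⇒∣ᵤ (Signed.divides t (cancel j t))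
  where
  cancel : ∀ j t → (j + t * + 2) - j ≡ t * + 2
  cancel = solve-∀

≡₂⇒≈₂ : ∀ {i j} → i ≡₂ j → i ≈₂ j
≡₂⇒≈₂ {i} {j} i≡₂j with Signed.∣ᵤ⇒∣ i≡₂j
... | Signed.divides t i-j≡2t = ≈₂-by t (trans (split i j) (cong (λ k → j + k) i-j≡2t))
  where
  split : ∀ i j → i ≡ j + (i - j)
  split = solve-∀

≈₂-refl : ∀ {i} → i ≈₂ i
≈₂-refl {i} = ≈₂-by (+ 0) (identity i)
  where
  identity : ∀ i → i ≡ i + + 0 * + 2
  identity = solve-∀

≈₂-trans : ∀ {i j k} → i ≈₂ j → j ≈₂ k → i ≈₂ k
≈₂-trans {k = k} (≈₂-by t refl) (≈₂-by u refl) = ≈₂-by (t + u) (identity k t u)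
  where
  identity : ∀ k t u → (k + u * + 2) + t * + 2 ≡ k + (t + u) * + 2
  identity = solve-∀

≈₂-+ : ∀ {i i′ j j′} → i ≈₂ i′ → j ≈₂ j′ → i + j ≈₂ i′ + j′
≈₂-+ {i′ = i′} {j′ = j′} (≈₂-by t refl) (≈₂-by u refl) = ≈₂-by (t + u) (identity i′ j′ t u)
  where
  identity : ∀ i j t u → (i + t * + 2) + (j + u * + 2) ≡ (i + j) + (t + u) * + 2
  identity = solve-∀

≈₂-* : ∀ {i i′ j j′} → i ≈₂ i′ → j ≈₂ j′ → i * j ≈₂ i′ * j′
≈₂-* {i′ = i′} {j′ = j′} (≈₂-by t refl) (≈₂-by u refl) =
  ≈₂-by (t * j′ + i′ * u + t * u * + 2) (identity i′ j′ t u)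
  where
  identity : ∀ i j t u →
    (i + t * + 2) * (j + u * + 2) ≡ i * j + (t * j + i * u + t * u * + 2) * + 2
  identity = solve-∀

≈₂-neg : ∀ {i i′} → i ≈₂ i′ → - i ≈₂ - i′
≈₂-neg {i′ = i′} (≈₂-by t refl) = ≈₂-by (- t) (identity i′ t)
  where
  identity : ∀ i t → - (i + t * + 2) ≡ - i + - t * + 2
  identity = solve-∀

≈₂-- : ∀ {i i′ j j′} → i ≈₂ i′ → j ≈₂ j′ → i - j ≈₂ i′ - j′
≈₂-- i≈i′ j≈j′ = ≈₂-+ i≈i′ (≈₂-neg j≈j′)

2≈₂0 : + 2 ≈₂ + 0
2≈₂0 = ≈₂-by (+ 1) refl

-1≈₂1 : -[1+ 0 ] ≈₂ + 1
-1≈₂1 = ≈₂-by -[1+ 0 ] refl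

0≉₂1 : ¬ (+ 0 ≈₂ + 1)
0≉₂1 0≈1 with ℕ.∣1⇒≡1 (≈₂⇒≡₂ 0≈1)
... | ()

1≉₂0 : ¬ (+ 1 ≈₂ + 0)
1≉₂0 1≈0 with ℕ.∣1⇒≡1 (≈₂⇒≡₂ 1≈0)
... | ()

odd⇒≢0 : ∀ {i} → i ≈₂ + 1 → i ≢ + 0
odd⇒≢0 i≈1 refl = 0≉₂1 i≈1

odd∧nonNeg⇒pos : ∀ {i} → i ≈₂ + 1 → + 0 ≤ i → + 1 ≤ i
odd∧nonNeg⇒pos i≈1 0≤i = nonNeg∧≢0⇒pos 0≤i (odd⇒≢0 i≈1)

OddPos⇒odd : ∀ {i} → OddPos i → i ≈₂ + 1
OddPos⇒odd (k , refl) = ≈₂-by (+ k) (identity (+ k))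
  where
  identity : ∀ k → + 1 + + 2 * k ≡ + 1 + k * + 2
  identity = solve-∀

odd∧nonNeg⇒OddPos : ∀ {i} → i ≈₂ + 1 → + 0 ≤ i → OddPos i
odd∧nonNeg⇒OddPos (≈₂-by (+ k) refl) _ = k , identity (+ k)
  where
  identity : ∀ k → + 1 + k * + 2 ≡ + 1 + + 2 * k
  identity = solve-∀
odd∧nonNeg⇒OddPos (≈₂-by -[1+ k ] refl) 0≤i =
  ⊥-elim (nonNeg≢-1 (nonNeg-+ 0≤i (nonNeg-* (nonNeg-ℕ 2) (nonNeg-ℕ k))) (identity (+ k)))
  where
  identity : ∀ k → (+ 1 + (- (+ 1 + k)) * + 2) + + 2 * k ≡ -[1+ 0 ]
  identity = solve-∀

OddPos⇒pos : ∀ {i} → OddPos i → + 1 ≤ i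
OddPos⇒pos (k , refl) = ≤-via (+ 2 * + k) (identity (+ k)) (nonNeg-* (nonNeg-ℕ 2) (nonNeg-ℕ k))
  where
  identity : ∀ k → (+ 1 + + 2 * k) - + 1 ≡ + 2 * k
  identity = solve-∀

Sign⇒odd : ∀ {e} → Sign e → e ≈₂ + 1
Sign⇒odd (inj₁ refl) = ≈₂-refl
Sign⇒odd (inj₂ refl) = -1≈₂1

OddPos⇒2≤i+1 : ∀ {i} → OddPos i → + 2 ≤ i + + 1
OddPos⇒2≤i+1 {i} i-odd = ≤-via (i - + 1) (identity i) (i≤j⇒0≤j-i (OddPos⇒pos i-odd))
  where
  identity : ∀ i → (i + + 1) - + 2 ≡ i - + 1
  identity = solve-∀

2≤i-1⇒3≤i : ∀ {i} → + 2 ≤ i + -[1+ 0 ] → + 3 ≤ i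
2≤i-1⇒3≤i {i} 2≤i-1 = ≤-via ((i + -[1+ 0 ]) - + 2) (identity i) (i≤j⇒0≤j-i 2≤i-1)
  where
  identity : ∀ i → i - + 3 ≡ (i + -[1+ 0 ]) - + 2
  identity = solve-∀

3≤i⇒2≤i-1 : ∀ {i} → + 3 ≤ i → + 2 ≤ i + -[1+ 0 ]
3≤i⇒2≤i-1 {i} 3≤i = ≤-via (i - + 3) (identity i) (i≤j⇒0≤j-i 3≤i)
  where
  identity : ∀ i → (i + -[1+ 0 ]) - + 2 ≡ i - + 3
  identity = solve-∀

OddPos∧2≤⇒3≤ : ∀ {i} → OddPos i → + 2 ≤ i → + 3 ≤ i
OddPos∧2≤⇒3≤ (zero , refl) (+≤+ (ℕ.s≤s ()))
OddPos∧2≤⇒3≤ (suc k , refl) _ = ≤-via (+ 2 * + k) (identity (+ k)) (nonNeg-* (nonNeg-ℕ 2) (nonNeg-ℕ k))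
  where
  identity : ∀ k → (+ 1 + + 2 * (+ 1 + k)) - + 3 ≡ + 2 * k
  identity = solve-∀

digit-admissible : ∀ {a e} → OddPos a → Sign e → (e ≡ -[1+ 0 ] → + 3 ≤ a) → + 2 ≤ a + e
digit-admissible a-odd (inj₁ refl) _     = OddPos⇒2≤i+1 a-odd
digit-admissible _     (inj₂ refl) large = 3≤i⇒2≤i-1 (large refl)

_≈M₂_ : Mat → Mat → Set
σ ≈M₂ τ = (m11 σ ≈₂ m11 τ) × (m12 σ ≈₂ m12 τ) × (m21 σ ≈₂ m21 τ) × (m22 σ ≈₂ m22 τ)

ParityClass : Mat → Set
ParityClass σ = σ ≈M₂ I ⊎ σ ≈M₂ Amat ⊎ σ ≈M₂ Bmat

ParityClass⇒congruent : ∀ σ → ParityClass σ → σ ≡M₂ I ⊎ σ ≡M₂ Amat ⊎ σ ≡M₂ Bmat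
ParityClass⇒congruent σ = Sum.map convert (Sum.map convert convert)
  where
  convert : ∀ {τ} → σ ≈M₂ τ → σ ≡M₂ τ
  convert (p , q , r , s) = ≈₂⇒≡₂ p , ≈₂⇒≡₂ q , ≈₂⇒≡₂ r , ≈₂⇒≡₂ s

congruent⇒ParityClass : ∀ σ → σ ≡M₂ I ⊎ σ ≡M₂ Amat ⊎ σ ≡M₂ Bmat → ParityClass σ
congruent⇒ParityClass σ = Sum.map convert (Sum.map convert convert)
  where
  convert : ∀ {τ} → σ ≡M₂ τ → σ ≈M₂ τ
  convert (p , q , r , s) = ≡₂⇒≈₂ p , ≡₂⇒≈₂ q , ≡₂⇒≈₂ r , ≡₂⇒≈₂ s

parityClass-⊗M : ∀ {a e b b′ d d′} → a ≈₂ + 1 → e ≈₂ + 1 → ParityClass (mat b b′ d d′) →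
  ParityClass (mat (a * b + e * b′) b (a * d + e * d′) d)
parityClass-⊗M a≈1 e≈1 (inj₁ (b≈ , b′≈ , d≈ , d′≈)) =
  inj₂ (inj₂ (≈₂-+ (≈₂-* a≈1 b≈) (≈₂-* e≈1 b′≈) , b≈ ,
              ≈₂-+ (≈₂-* a≈1 d≈) (≈₂-* e≈1 d′≈) , d≈))
parityClass-⊗M a≈1 e≈1 (inj₂ (inj₁ (b≈ , b′≈ , d≈ , d′≈))) =
  inj₁ (≈₂-+ (≈₂-* a≈1 b≈) (≈₂-* e≈1 b′≈) , b≈ ,
        ≈₂-trans (≈₂-+ (≈₂-* a≈1 d≈) (≈₂-* e≈1 d′≈)) 2≈₂0 , d≈)
parityClass-⊗M a≈1 e≈1 (inj₂ (inj₂ (b≈ , b′≈ , d≈ , d′≈))) =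
  inj₂ (inj₁ (≈₂-trans (≈₂-+ (≈₂-* a≈1 b≈) (≈₂-* e≈1 b′≈)) 2≈₂0 , b≈ ,
              ≈₂-+ (≈₂-* a≈1 d≈) (≈₂-* e≈1 d′≈) , d≈))

parityClass-⊗M⁻¹ : ∀ {a e A B C D} → a ≈₂ + 1 → e ≈₂ + 1 → ParityClass (mat A B C D) →
  ParityClass (mat B (e * (A - a * B)) D (e * (C - a * D)))
parityClass-⊗M⁻¹ a≈1 e≈1 (inj₁ (A≈ , B≈ , C≈ , D≈)) =
  inj₂ (inj₁ (B≈ , ≈₂-* e≈1 (≈₂-- A≈ (≈₂-* a≈1 B≈)) ,
              D≈ , ≈₂-trans (≈₂-* e≈1 (≈₂-- C≈ (≈₂-* a≈1 D≈))) -1≈₂1))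
parityClass-⊗M⁻¹ a≈1 e≈1 (inj₂ (inj₁ (A≈ , B≈ , C≈ , D≈))) =
  inj₂ (inj₂ (B≈ , ≈₂-trans (≈₂-* e≈1 (≈₂-- A≈ (≈₂-* a≈1 B≈))) -1≈₂1 ,
              D≈ , ≈₂-* e≈1 (≈₂-- C≈ (≈₂-* a≈1 D≈))))
parityClass-⊗M⁻¹ a≈1 e≈1 (inj₂ (inj₂ (A≈ , B≈ , C≈ , D≈))) =
  inj₁ (B≈ , ≈₂-* e≈1 (≈₂-- A≈ (≈₂-* a≈1 B≈)) ,
        D≈ , ≈₂-* e≈1 (≈₂-- C≈ (≈₂-* a≈1 D≈)))

-- Products of the matrices M(a, e)

mat-cong : ∀ {a b c d a′ b′ c′ d′} → a ≡ a′ → b ≡ b′ → c ≡ c′ → d ≡ d′ →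
           mat a b c d ≡ mat a′ b′ c′ d′
mat-cong refl refl refl refl = refl

⊗-assoc : ∀ σ τ υ → (σ ⊗ τ) ⊗ υ ≡ σ ⊗ (τ ⊗ υ)
⊗-assoc (mat a b c d) (mat e f g h) (mat i j k l) =
  mat-cong (entry a b e f g h i k) (entry a b e f g h j l)
           (entry c d e f g h i k) (entry c d e f g h j l)
  where
  entry : ∀ p q r s t v u w →
    (p * r + q * t) * u + (p * s + q * v) * w ≡ p * (r * u + s * w) + q * (t * u + v * w)
  entry = solve-∀

⊗-identityʳ : ∀ σ → σ ⊗ I ≡ σ
⊗-identityʳ (mat a b c d) = mat-cong (left a b) (right a b) (left c d) (right c d)
  where
  left : ∀ p q → p * + 1 + q * + 0 ≡ p
  left = solve-∀
  right : ∀ p q → p * + 0 + q * + 1 ≡ q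
  right = solve-∀

⊗-M : ∀ x y z w a e → mat x y z w ⊗ M a e ≡ mat (a * x + e * y) x (a * z + e * w) z
⊗-M x y z w a e = mat-cong (left x y a e) (right x y) (left z w a e) (right z w)
  where
  left : ∀ x y a e → x * a + y * e ≡ a * x + e * y
  left = solve-∀
  right : ∀ x y → x * + 1 + y * + 0 ≡ x
  right = solve-∀

det-⊗ : ∀ σ τ → det (σ ⊗ τ) ≡ det σ * det τ
det-⊗ (mat a b c d) (mat e f g h) = identity a b c d e f g h
  where
  identity : ∀ a b c d e f g h →
    (a * e + b * g) * (c * f + d * h) - (a * f + b * h) * (c * e + d * g)
      ≡ (a * d - b * c) * (e * h - f * g)
  identity = solve-∀

det-M : ∀ a e → det (M a e) ≡ - e
det-M = identity
  where
  identity : ∀ a e → a * + 0 - + 1 * e ≡ - e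
  identity = solve-∀

Sign[det]-⊗M : ∀ {σ a e} → Sign e → Sign (det σ) → Sign (det (σ ⊗ M a e))
Sign[det]-⊗M {σ} {a} {e} se sσ =
  subst Sign (sym (trans (det-⊗ σ (M a e)) (cong (det σ *_) (det-M a e))))
        (Sign-* sσ (Sign-neg se))

Sign[det]-⊗M⁻¹ : ∀ {σ a e} → Sign e → Sign (det (σ ⊗ M a e)) → Sign (det σ)
Sign[det]-⊗M⁻¹ {σ} {a} {e} se sσM =
  Sign-cancelʳ (Sign-neg se)
    (subst Sign (trans (det-⊗ σ (M a e)) (cong (det σ *_) (det-M a e))) sσM)

-- In snoc, the sign e of the new factor M(a, e) is the sign paired with the previous digit a′.
data Admissible : Mat → ℤ → Set where
  single : ∀ {a} → OddPos a → Admissible (M a (+ 1)) a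
  snoc   : ∀ {σ a′ a e} → Admissible σ a′ → OddPos a → Sign e → + 2 ≤ a′ + e →
           Admissible (σ ⊗ M a e) a

Admissible⇒OddPos : ∀ {σ a} → Admissible σ a → OddPos a
Admissible⇒OddPos (single a-odd)     = a-odd
Admissible⇒OddPos (snoc _ a-odd _ _) = a-odd

Admissible⊗prodFrom⇒InP : ∀ {σ a} → Admissible σ a → ∀ e ds →
  ValidDigit (a , e) → All ValidDigit ds → InP (σ ⊗ prodFrom e ds)
Admissible⊗prodFrom⇒InP (single {a} _) e ds valid valids = (a , e) , ds , valid ∷ valids , refl
Admissible⊗prodFrom⇒InP (snoc {σ} {a′} {a} {e} exp _ se 2≤a′+e) e′ ds valid valids =
  subst InP (sym (⊗-assoc σ (M a e) (prodFrom e′ ds)))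
    (Admissible⊗prodFrom⇒InP exp e ((a , e′) ∷ ds)
      (Admissible⇒OddPos exp , se , 2≤a′+e) (valid ∷ valids))

Admissible⇒InP : ∀ {σ a} → Admissible σ a → InP σ
Admissible⇒InP {σ} exp = subst InP (⊗-identityʳ σ)
  (Admissible⊗prodFrom⇒InP exp (+ 1) []
    (a-odd , inj₁ refl , OddPos⇒2≤i+1 a-odd) [])
  where a-odd = Admissible⇒OddPos exp

Admissible⊗prodFrom : ∀ {σ a} → Admissible σ a → ∀ e ds →
  ValidDigit (a , e) → All ValidDigit ds → ∃ (Admissible (σ ⊗ prodFrom e ds))
Admissible⊗prodFrom {σ} {a} exp e [] _ [] =
  a , subst (λ τ → Admissible τ a) (sym (⊗-identityʳ σ)) exp
Admissible⊗prodFrom {σ} exp e ((a , e′) ∷ ds) (_ , se , 2≤+) (valid ∷ valids)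
  with Admissible⊗prodFrom (snoc exp (proj₁ valid) se 2≤+) e′ ds valid valids
... | last , exp′ = last , subst (λ τ → Admissible τ last) (⊗-assoc σ (M a e) (prodFrom e′ ds)) exp′

InP⇒Admissible : ∀ {σ} → InP σ → ∃ (Admissible σ)
InP⇒Admissible ((a , e) , ds , valid ∷ valids , refl) =
  Admissible⊗prodFrom (single (proj₁ valid)) e ds valid valids

Bounded : Mat → Set
Bounded σ = (+ 0 ≤ m22 σ) × (m22 σ ≤ m12 σ) × (+ 1 ≤ m21 σ) × (m21 σ ≤ m11 σ)

scaleRow₂ : ℤ → Mat → Mat
scaleRow₂ e (mat x y z w) = mat x y (e * z) (e * w)

M⊗-scaleRow₂ : ∀ a e σ → M a e ⊗ σ ≡ scaleRow₂ e (M a (+ 1) ⊗ σ)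
M⊗-scaleRow₂ a e (mat p q r s) = mat-cong refl refl (entry e p r) (entry e q s)
  where
  entry : ∀ e p r → e * p + + 0 * r ≡ e * (+ 1 * p + + 0 * r)
  entry = solve-∀

M⊗scaleRow₂ : ∀ a e x y z w →
  M a (+ 1) ⊗ scaleRow₂ e (mat x y z w) ≡ mat (a * x + e * z) (a * y + e * w) x y
M⊗scaleRow₂ a e x y z w = mat-cong (top a e x z) (top a e y w) (bottom x z e) (bottom y w e)
  where
  top : ∀ a e x z → a * x + + 1 * (e * z) ≡ a * x + e * z
  top = solve-∀
  bottom : ∀ x z e → + 1 * x + + 0 * (e * z) ≡ x
  bottom = solve-∀

≤-digitCombination : ∀ {a e y w} → OddPos a → Sign e → + 2 ≤ a + e →
  + 0 ≤ w → w ≤ y → y ≤ a * y + e * w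
≤-digitCombination {a} {y = y} {w} a-odd (inj₁ refl) _ 0≤w w≤y =
  ≤-via ((a - + 1) * y + w) (identity a y w)
    (nonNeg-+ (nonNeg-* (i≤j⇒0≤j-i (OddPos⇒pos a-odd)) (≤-trans 0≤w w≤y)) 0≤w)
  where
  identity : ∀ a y w → (a * y + + 1 * w) - y ≡ (a - + 1) * y + w
  identity = solve-∀
≤-digitCombination {a} {y = y} {w} _ (inj₂ refl) 2≤a-1 0≤w w≤y =
  ≤-via ((a - + 3) * y + (y + (y - w))) (identity a y w)
    (nonNeg-+ (nonNeg-* 0≤a-3 0≤y) (nonNeg-+ 0≤y (i≤j⇒0≤j-i w≤y)))
  where
  0≤y = ≤-trans 0≤w w≤y
  0≤a-3 : + 0 ≤ a - + 3
  0≤a-3 = subst (+ 0 ≤_) (shift a) (i≤j⇒0≤j-i 2≤a-1)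
    where
    shift : ∀ a → (a + -[1+ 0 ]) - + 2 ≡ a - + 3
    shift = solve-∀
  identity : ∀ a y w → (a * y + -[1+ 0 ] * w) - y ≡ (a - + 3) * y + (y + (y - w))
  identity = solve-∀

Bounded-step : ∀ {a e x y z w} → OddPos a → Sign e → + 2 ≤ a + e →
  Bounded (mat x y z w) → Bounded (mat (a * x + e * z) (a * y + e * w) x y)
Bounded-step a-odd se 2≤a+e (0≤w , w≤y , 1≤z , z≤x) =
  0≤y , ≤-digitCombination a-odd se 2≤a+e 0≤w w≤y ,
  ≤-trans 1≤z z≤x , ≤-digitCombination a-odd se 2≤a+e (≤-trans (nonNeg-ℕ 1) 1≤z) z≤x
  where 0≤y = ≤-trans 0≤w w≤y

prodFrom-Bounded : ∀ a e ds → ValidDigit (a , e) → All ValidDigit ds →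
  Bounded (prodFrom (+ 1) ((a , e) ∷ ds))
prodFrom-Bounded a e [] (a-odd , _) [] =
  subst Bounded (sym (⊗-identityʳ (M a (+ 1))))
    (nonNeg-ℕ 0 , nonNeg-ℕ 1 , +≤+ (ℕ.s≤s ℕ.z≤n) , OddPos⇒pos a-odd)
prodFrom-Bounded a e ((a′ , e′) ∷ ds) (a-odd , se , 2≤a+e) (valid ∷ valids) =
  subst (λ τ → Bounded (M a (+ 1) ⊗ τ)) (sym (M⊗-scaleRow₂ a′ e (prodFrom e′ ds)))
    (step (prodFrom (+ 1) ((a′ , e′) ∷ ds)) (prodFrom-Bounded a′ e′ ds valid valids))
  where
  step : ∀ τ → Bounded τ → Bounded (M a (+ 1) ⊗ scaleRow₂ e τ)
  step (mat x y z w) bounded =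
    subst Bounded (sym (M⊗scaleRow₂ a e x y z w)) (Bounded-step a-odd se 2≤a+e bounded)

InP⇒Bounded : ∀ {σ} → InP σ → Bounded σ
InP⇒Bounded ((a , e) , ds , valid ∷ valids , refl) = prodFrom-Bounded a e ds valid valids

-- Comparison with the golden ratio

N : ℤ → ℤ → ℤ
N x y = x * x + x * y - y * y

Ratio>g : ℤ → ℤ → Set
Ratio>g x y = + 1 ≤ N x y

Ratio>2+g : ℤ → ℤ → Set
Ratio>2+g x y = + 2 * y ≤ x × Ratio>g (x - + 2 * y) y

Ratio>g⇒GtG : ∀ x y → Ratio>g x y → GtG x y
Ratio>g⇒GtG x y 1≤N = suc[i]≤j⇒i<j
  (≤-via (+ 4 * (N x y - + 1) + + 3) (identity x y)
    (nonNeg-+ (nonNeg-* (nonNeg-ℕ 4) (i≤j⇒0≤j-i 1≤N)) (nonNeg-ℕ 3)))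
  where
  identity : ∀ x y → (+ 2 * x + y) * (+ 2 * x + y) - (+ 1 + + 5 * (y * y))
                       ≡ + 4 * ((x * x + x * y - y * y) - + 1) + + 3
  identity = solve-∀

GtG⇒Ratio>g : ∀ x y → GtG x y → Ratio>g x y
GtG⇒Ratio>g x y gtg with + 1 ≤? N x y
... | yes 1≤N = 1≤N
... | no  1≰N = ⊥-elim (nonNeg≢-1
  (nonNeg-+ (i≤j⇒0≤j-i (i<j⇒suc[i]≤j gtg)) (nonNeg-* (nonNeg-ℕ 4) (i≤j⇒0≤j-i (≰⇒1+≤ 1≰N))))
  (identity x y))
  where
  identity : ∀ x y → ((+ 2 * x + y) * (+ 2 * x + y) - (+ 1 + + 5 * (y * y)))
                       + + 4 * (+ 1 - (+ 1 + (x * x + x * y - y * y))) ≡ -[1+ 0 ]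
  identity = solve-∀

Ratio>g∧nonNeg⇒pos : ∀ {x y} → + 0 ≤ y → Ratio>g x y → + 0 ≤ x → + 1 ≤ x
Ratio>g∧nonNeg⇒pos {x} {y} 0≤y 1≤N 0≤x = nonNeg∧≢0⇒pos 0≤x x≢0
  where
  x≢0 : x ≢ + 0
  x≢0 refl = nonNeg≢-1 (nonNeg-+ (i≤j⇒0≤j-i 1≤N) (nonNeg-* 0≤y 0≤y)) (identity y)
    where
    identity : ∀ y → ((+ 0 * + 0 + + 0 * y - y * y) - + 1) + y * y ≡ -[1+ 0 ]
    identity = solve-∀

Ratio>g-1 : ∀ {x} → + 1 ≤ x → Ratio>g x (+ 1)
Ratio>g-1 {x} 1≤x = ≤-via ((x - + 1) * ((x - + 1) + + 3)) (identity x)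
  (nonNeg-* 0≤x-1 (nonNeg-+ 0≤x-1 (nonNeg-ℕ 3)))
  where
  0≤x-1 = i≤j⇒0≤j-i 1≤x
  identity : ∀ x → (x * x + x * + 1 - + 1 * + 1) - + 1 ≡ (x - + 1) * ((x - + 1) + + 3)
  identity = solve-∀

N-odd : ∀ {A B C D} → ParityClass (mat A B C D) → N A B ≈₂ + 1
N-odd (inj₁ (A≈ , B≈ , _)) = ≈₂-- (≈₂-+ (≈₂-* A≈ A≈) (≈₂-* A≈ B≈)) (≈₂-* B≈ B≈)
N-odd (inj₂ (inj₁ (A≈ , B≈ , _))) =
  ≈₂-trans (≈₂-- (≈₂-+ (≈₂-* A≈ A≈) (≈₂-* A≈ B≈)) (≈₂-* B≈ B≈)) -1≈₂1
N-odd (inj₂ (inj₂ (A≈ , B≈ , _))) = ≈₂-- (≈₂-+ (≈₂-* A≈ A≈) (≈₂-* A≈ B≈)) (≈₂-* B≈ B≈)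

Ratio>g-step : ∀ {a e b b′} → + 1 ≤ a → Sign e → + 1 ≤ b → + 0 ≤ b′ →
  (e ≡ -[1+ 0 ] → Ratio>2+g b b′) → + 0 ≤ a * b + e * b′ × Ratio>g (a * b + e * b′) b
Ratio>g-step {a} {b = b} {b′} 1≤a (inj₁ refl) 1≤b 0≤b′ _ =
  ≤-via (w + b) (identity₀ a b b′) (nonNeg-+ 0≤w 0≤b) ,
  ≤-via (v * (v + + 2) + b * w) (identity₁ a b b′)
    (nonNeg-+ (nonNeg-* 0≤v (nonNeg-+ 0≤v (nonNeg-ℕ 2))) (nonNeg-* 0≤b 0≤w))
  where
  0≤b = ≤-trans (nonNeg-ℕ 1) 1≤b
  w = (a - + 1) * b + b′
  0≤w : + 0 ≤ w
  0≤w = nonNeg-+ (nonNeg-* (i≤j⇒0≤j-i 1≤a) 0≤b) 0≤b′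
  v = w + (b - + 1)
  0≤v : + 0 ≤ v
  0≤v = nonNeg-+ 0≤w (i≤j⇒0≤j-i 1≤b)
  identity₀ : ∀ a b b′ → (a * b + + 1 * b′) - + 0 ≡ (a - + 1) * b + b′ + b
  identity₀ = solve-∀
  identity₁ : ∀ a b b′ →
    ((a * b + + 1 * b′) * (a * b + + 1 * b′) + (a * b + + 1 * b′) * b - b * b) - + 1
      ≡ ((a - + 1) * b + b′ + (b - + 1)) * ((a - + 1) * b + b′ + (b - + 1) + + 2)
        + b * ((a - + 1) * b + b′)
  identity₁ = solve-∀
Ratio>g-step {a} {b = b} {b′} 1≤a (inj₂ refl) 1≤b 0≤b′ large with large refl
... | 2b′≤b , 1≤N′ =
  ≤-via (w + b′) (identity₀ a b b′) (nonNeg-+ 0≤w 0≤b′) ,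
  ≤-via ((N (b - + 2 * b′) b′ - + 1) + (a - + 1) * b * (w + + 2 * b)) (identity₁ a b b′)
    (nonNeg-+ (i≤j⇒0≤j-i 1≤N′)
      (nonNeg-* (nonNeg-* (i≤j⇒0≤j-i 1≤a) 0≤b) (nonNeg-+ 0≤w (nonNeg-* (nonNeg-ℕ 2) 0≤b))))
  where
  0≤b = ≤-trans (nonNeg-ℕ 1) 1≤b
  w = (a - + 1) * b + (b - + 2 * b′)
  0≤w : + 0 ≤ w
  0≤w = nonNeg-+ (nonNeg-* (i≤j⇒0≤j-i 1≤a) 0≤b) (i≤j⇒0≤j-i 2b′≤b)
  identity₀ : ∀ a b b′ → (a * b + -[1+ 0 ] * b′) - + 0 ≡ (a - + 1) * b + (b - + 2 * b′) + b′
  identity₀ = solve-∀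
  identity₁ : ∀ a b b′ →
    ((a * b + -[1+ 0 ] * b′) * (a * b + -[1+ 0 ] * b′) + (a * b + -[1+ 0 ] * b′) * b - b * b) - + 1
      ≡ (((b - + 2 * b′) * (b - + 2 * b′) + (b - + 2 * b′) * b′ - b′ * b′) - + 1)
        + (a - + 1) * b * ((a - + 1) * b + (b - + 2 * b′) + + 2 * b)
  identity₁ = solve-∀

Ratio>2+g-step : ∀ {a e b b′} → + 3 ≤ a → Sign e → + 1 ≤ b → + 0 ≤ b′ →
  (e ≡ -[1+ 0 ] → Ratio>2+g b b′) → Ratio>2+g (a * b + e * b′) b
Ratio>2+g-step {a} {e} {b} {b′} 3≤a se 1≤b 0≤b′ large
  with Ratio>g-step {a - + 2} 1≤a-2 se 1≤b 0≤b′ large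
  where
  1≤a-2 : + 1 ≤ a - + 2
  1≤a-2 = ≤-via (a - + 3) (shift a) (i≤j⇒0≤j-i 3≤a)
    where
    shift : ∀ a → (a - + 2) - + 1 ≡ a - + 3
    shift = solve-∀
... | 0≤x , ratio =
  ≤-via ((a - + 2) * b + e * b′) (identity a e b b′) 0≤x ,
  subst (λ x → Ratio>g x b) (sym (identity a e b b′)) ratio
  where
  identity : ∀ a e b b′ → (a * b + e * b′) - + 2 * b ≡ (a - + 2) * b + e * b′
  identity = solve-∀

-- From 𝒫̃ to 𝒮

record Invariant (σ : Mat) (a : ℤ) : Set where
  field
    unimodular  : Sign (det σ)
    parity      : ParityClass σ
    1≤m11       : + 1 ≤ m11 σ
    0≤m12       : + 0 ≤ m12 σ
    ratio       : Ratio>g (m11 σ) (m12 σ)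
    ratio-large : + 3 ≤ a → Ratio>2+g (m11 σ) (m12 σ)

Admissible⇒Invariant : ∀ {σ a} → Admissible σ a → Invariant σ a
Admissible⇒Invariant (single {a} a-odd) = record
  { unimodular  = inj₂ (det≡-1 a)
  ; parity      = inj₂ (inj₂ (OddPos⇒odd a-odd , ≈₂-refl , ≈₂-refl , ≈₂-refl))
  ; 1≤m11       = OddPos⇒pos a-odd
  ; 0≤m12       = nonNeg-ℕ 1
  ; ratio       = Ratio>g-1 (OddPos⇒pos a-odd)
  ; ratio-large = λ 3≤a → ≤-via ((a - + 3) + + 1) (identity a) (nonNeg-+ (i≤j⇒0≤j-i 3≤a) (nonNeg-ℕ 1)) ,
                          Ratio>g-1 {a - + 2 * + 1} (≤-via (a - + 3) (identity′ a) (i≤j⇒0≤j-i 3≤a))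
  }
  where
  det≡-1 : ∀ a → a * + 0 - + 1 * + 1 ≡ -[1+ 0 ]
  det≡-1 = solve-∀
  identity : ∀ a → a - + 2 * + 1 ≡ (a - + 3) + + 1
  identity = solve-∀
  identity′ : ∀ a → (a - + 2 * + 1) - + 1 ≡ a - + 3
  identity′ = solve-∀
Admissible⇒Invariant (snoc {mat b b′ d d′} {a′} {a} {e} exp a-odd se 2≤a′+e) =
  subst (λ τ → Invariant τ a) (sym (⊗-M b b′ d d′ a e)) (record
    { unimodular  = subst (Sign ∘ det) (⊗-M b b′ d d′ a e) (Sign[det]-⊗M {mat b b′ d d′} {a} se unimodular)
    ; parity      = parityClass-⊗M (OddPos⇒odd a-odd) (Sign⇒odd se) parity
    ; 1≤m11       = Ratio>g∧nonNeg⇒pos {a * b + e * b′} (≤-trans (nonNeg-ℕ 1) 1≤m11) ratio′ 0≤x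
    ; 0≤m12       = ≤-trans (nonNeg-ℕ 1) 1≤m11
    ; ratio       = ratio′
    ; ratio-large = λ 3≤a → Ratio>2+g-step 3≤a se 1≤m11 0≤m12 ratio-large-if-e≡-1
    })
  where
  open Invariant (Admissible⇒Invariant exp)
  ratio-large-if-e≡-1 : e ≡ -[1+ 0 ] → Ratio>2+g b b′
  ratio-large-if-e≡-1 refl = ratio-large (2≤i-1⇒3≤i 2≤a′+e)
  0≤x×ratio′ = Ratio>g-step (OddPos⇒pos a-odd) se 1≤m11 0≤m12 ratio-large-if-e≡-1
  0≤x = proj₁ 0≤x×ratio′
  ratio′ = proj₂ 0≤x×ratio′

InP⇒InS : ∀ σ → InP σ → InS σ
InP⇒InS σ σ∈P with InP⇒Admissible σ∈P | InP⇒Bounded σ∈P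
... | _ , exp | 0≤d , d≤b , 1≤c , c≤a =
  (unimodular , ParityClass⇒congruent σ parity) , 0≤d , d≤b , 1≤c , c≤a ,
  Ratio>g⇒GtG (m11 σ) (m12 σ) ratio
  where open Invariant (Admissible⇒Invariant exp)

-- One step of the odd continued fraction algorithm

record OddStep (A B : ℤ) : Set where
  field
    a e b′      : ℤ
    a-odd       : OddPos a
    sign        : Sign e
    A≡aB+eb′    : A ≡ a * B + e * b′
    0≤b′        : + 0 ≤ b′
    b′<A        : + 1 + b′ ≤ A
    ratio       : Ratio>g B b′
    ratio-large : e ≡ -[1+ 0 ] → Ratio>2+g B b′
    a-large     : Ratio>2+g A B → + 3 ≤ a

N[x-2y,y]≡-N[y,x-y] : ∀ x y → N (x - + 2 * y) y ≡ - N y (x - y)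
N[x-2y,y]≡-N[y,x-y] = identity
  where
  identity : ∀ x y → (x - + 2 * y) * (x - + 2 * y) + (x - + 2 * y) * y - y * y
                       ≡ - (y * y + y * (x - y) - (x - y) * (x - y))
  identity = solve-∀

N[x-2y,y]≈₂N[x,y] : ∀ x y → N (x - + 2 * y) y ≈₂ N x y
N[x-2y,y]≈₂N[x,y] x y = ≈₂-by (y * y - + 2 * x * y) (identity x y)
  where
  identity : ∀ x y → (x - + 2 * y) * (x - + 2 * y) + (x - + 2 * y) * y - y * y
                       ≡ (x * x + x * y - y * y) + (y * y - + 2 * x * y) * + 2
  identity = solve-∀

Ratio>g⇒y<2x : ∀ {x y} → + 0 ≤ x → + 0 ≤ y → Ratio>g x y → + 1 + y ≤ + 2 * x
Ratio>g⇒y<2x {x} {y} 0≤x 0≤y 1≤N with + 2 * x ≤? y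
... | no  2x≰y = ≰⇒1+≤ 2x≰y
... | yes 2x≤y = ⊥-elim (nonNeg≢-1
  (nonNeg-+ (i≤j⇒0≤j-i 1≤N) (nonNeg-+ (nonNeg-* (i≤j⇒0≤j-i 2x≤y) (nonNeg-+ 0≤y 0≤x)) (nonNeg-* 0≤x 0≤x)))
  (identity x y))
  where
  identity : ∀ x y → ((x * x + x * y - y * y) - + 1) + ((y - + 2 * x) * (y + x) + x * x) ≡ -[1+ 0 ]
  identity = solve-∀

oddStep-below1 : ∀ {A B} → + 1 + A ≤ B → + 0 ≤ A → Ratio>g A B → OddStep A B
oddStep-below1 {A} {B} A<B 0≤A ratio = record
  { a = + 1 ; e = -[1+ 0 ] ; b′ = B - A
  ; a-odd       = 0 , refl
  ; sign        = inj₂ refl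
  ; A≡aB+eb′    = identity₀ A B
  ; 0≤b′        = ≤-via (B - (+ 1 + A) + + 1) (identity₁ A B) 0≤[B-A]
  ; b′<A        = ≤-via (+ 2 * A - (+ 1 + B)) (identity₂ A B) (i≤j⇒0≤j-i B<2A)
  ; ratio       = ≤-via ((B - + 1) * (B - + 1 + + 2) + (B - (+ 1 + A) + + 1) * A) (identity₃ A B)
                    (nonNeg-+ (nonNeg-* (i≤j⇒0≤j-i 1≤B) (nonNeg-+ (i≤j⇒0≤j-i 1≤B) (nonNeg-ℕ 2)))
                              (nonNeg-* 0≤[B-A] 0≤A))
  ; ratio-large = λ _ → ≤-via (+ 2 * A - (+ 1 + B) + + 1) (identity₄ A B)
                          (nonNeg-+ (i≤j⇒0≤j-i B<2A) (nonNeg-ℕ 1)) ,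
                        subst (+ 1 ≤_) (identity₅ A B) ratio
  ; a-large     = λ { (2B≤A , _) → ⊥-elim (nonNeg≢-1
                    (nonNeg-+ (nonNeg-+ (nonNeg-+ (i≤j⇒0≤j-i 2B≤A) (i≤j⇒0≤j-i A<B)) (i≤j⇒0≤j-i 1≤B))
                              (nonNeg-ℕ 1))
                    (identity₆ A B)) }
  }
  where
  1≤B = ≤-trans (+-mono-≤ (≤-refl {+ 1}) 0≤A) A<B
  0≤[B-A] = nonNeg-+ (i≤j⇒0≤j-i A<B) (nonNeg-ℕ 1)
  B<2A = Ratio>g⇒y<2x 0≤A (≤-trans (nonNeg-ℕ 1) 1≤B) ratio
  identity₀ : ∀ A B → A ≡ + 1 * B + -[1+ 0 ] * (B - A)
  identity₀ = solve-∀
  identity₁ : ∀ A B → (B - A) - + 0 ≡ B - (+ 1 + A) + + 1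
  identity₁ = solve-∀
  identity₂ : ∀ A B → A - (+ 1 + (B - A)) ≡ + 2 * A - (+ 1 + B)
  identity₂ = solve-∀
  identity₃ : ∀ A B → (B * B + B * (B - A) - (B - A) * (B - A)) - + 1
                        ≡ (B - + 1) * (B - + 1 + + 2) + (B - (+ 1 + A) + + 1) * A
  identity₃ = solve-∀
  identity₄ : ∀ A B → B - + 2 * (B - A) ≡ + 2 * A - (+ 1 + B) + + 1
  identity₄ = solve-∀
  identity₅ : ∀ A B → A * A + A * B - B * B
    ≡ (B - + 2 * (B - A)) * (B - + 2 * (B - A)) + (B - + 2 * (B - A)) * (B - A) - (B - A) * (B - A)
  identity₅ = solve-∀
  identity₆ : ∀ A B → (((A - + 2 * B) + (B - (+ 1 + A))) + (B - + 1)) + + 1 ≡ -[1+ 0 ]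
  identity₆ = solve-∀

oddStep-above1 : ∀ {A B} → B ≤ A → + 1 ≤ B → Ratio>g B (A - B) → OddStep A B
oddStep-above1 {A} {B} B≤A 1≤B ratio = record
  { a = + 1 ; e = + 1 ; b′ = A - B
  ; a-odd       = 0 , refl
  ; sign        = inj₁ refl
  ; A≡aB+eb′    = identity₀ A B
  ; 0≤b′        = i≤j⇒0≤j-i B≤A
  ; b′<A        = ≤-via (B - + 1) (identity₁ A B) (i≤j⇒0≤j-i 1≤B)
  ; ratio       = ratio
  ; ratio-large = λ ()
  ; a-large     = λ { (_ , ratio′) → ⊥-elim (nonNeg≢-1
                    (nonNeg-+ (nonNeg-+ (i≤j⇒0≤j-i ratio′) (i≤j⇒0≤j-i ratio)) (nonNeg-ℕ 1))
                    (identity₂ A B)) }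
  }
  where
  identity₀ : ∀ A B → A ≡ + 1 * B + + 1 * (A - B)
  identity₀ = solve-∀
  identity₁ : ∀ A B → A - (+ 1 + (A - B)) ≡ B - + 1
  identity₁ = solve-∀
  identity₂ : ∀ A B → ((((A - + 2 * B) * (A - + 2 * B) + (A - + 2 * B) * B - B * B) - + 1) +
                        ((B * B + B * (A - B) - (A - B) * (A - B)) - + 1)) + + 1 ≡ -[1+ 0 ]
  identity₂ = solve-∀

x<2y⇒Ratio>g[y,x-y] : ∀ {x y} → y ≤ x → + 1 + x ≤ + 2 * y → + 1 ≤ y → Ratio>g y (x - y)
x<2y⇒Ratio>g[y,x-y] {x} {y} y≤x x<2y 1≤y =
  ≤-via ((x - y) * (+ 2 * y - (+ 1 + x) + + 1) + (y - + 1) * (y - + 1 + + 2)) (identity x y)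
    (nonNeg-+ (nonNeg-* (i≤j⇒0≤j-i y≤x) (nonNeg-+ (i≤j⇒0≤j-i x<2y) (nonNeg-ℕ 1)))
              (nonNeg-* (i≤j⇒0≤j-i 1≤y) (nonNeg-+ (i≤j⇒0≤j-i 1≤y) (nonNeg-ℕ 2))))
  where
  identity : ∀ x y → (y * y + y * (x - y) - (x - y) * (x - y)) - + 1
                       ≡ (x - y) * (+ 2 * y - (+ 1 + x) + + 1) + (y - + 1) * (y - + 1 + + 2)
  identity = solve-∀

oddStep-shift : ∀ {A B} → + 0 ≤ B → OddStep (A - + 2 * B) B → OddStep A B
oddStep-shift {A} {B} 0≤B step = record
  { a = a + + 2 ; e = e ; b′ = b′
  ; a-odd       = suc k , trans (cong (_+ + 2) a≡1+2k) (identity₀ (+ k))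
  ; sign        = sign
  ; A≡aB+eb′    = trans (identity₁ A B) (trans (cong (_+ + 2 * B) A≡aB+eb′) (identity₂ a B e b′))
  ; 0≤b′        = 0≤b′
  ; b′<A        = ≤-trans b′<A (≤-via (+ 2 * B) (identity₃ A B) (nonNeg-* (nonNeg-ℕ 2) 0≤B))
  ; ratio       = ratio
  ; ratio-large = ratio-large
  ; a-large     = λ _ → ≤-via (a - + 1) (identity₄ a) (i≤j⇒0≤j-i (OddPos⇒pos a-odd))
  }
  where
  open OddStep step
  k = proj₁ a-odd
  a≡1+2k = proj₂ a-odd
  identity₀ : ∀ k → + 1 + + 2 * k + + 2 ≡ + 1 + + 2 * (+ 1 + k)
  identity₀ = solve-∀
  identity₁ : ∀ A B → A ≡ (A - + 2 * B) + + 2 * B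
  identity₁ = solve-∀
  identity₂ : ∀ a B e b′ → (a * B + e * b′) + + 2 * B ≡ (a + + 2) * B + e * b′
  identity₂ = solve-∀
  identity₃ : ∀ A B → A - (A - + 2 * B) ≡ + 2 * B
  identity₃ = solve-∀
  identity₄ : ∀ a → (a + + 2) - + 3 ≡ a - + 1
  identity₄ = solve-∀

oddStep : ∀ n {A B} → + 1 + A ≤ + n → + 0 ≤ A → + 1 ≤ B → Ratio>g A B → N A B ≈₂ + 1 →
  OddStep A B
oddStep zero {A} A<0 0≤A _ _ _ with ≤-trans (+-mono-≤ (≤-refl {+ 1}) 0≤A) A<0
... | +≤+ ()
oddStep (suc n) {A} {B} A<1+n 0≤A 1≤B ratio odd with B ≤? A
... | no  B≰A = oddStep-below1 (≰⇒1+≤ B≰A) 0≤A ratio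
... | yes B≤A with + 1 ≤? N B (A - B)  -- N (A − 2B) B = − N B (A − B): is A/B < 2 + g?
...   | yes ratio′ = oddStep-above1 B≤A 1≤B ratio′
...   | no  ratio′≰ = oddStep-shift 0≤B (oddStep n A′<n 0≤A′ 1≤B ratio-shifted odd′)
  where
  0≤B = ≤-trans (nonNeg-ℕ 1) 1≤B
  2B≤A : + 2 * B ≤ A
  2B≤A with + 2 * B ≤? A
  ... | yes 2B≤A = 2B≤A
  ... | no  2B≰A = ⊥-elim (ratio′≰ (x<2y⇒Ratio>g[y,x-y] B≤A (≰⇒1+≤ 2B≰A) 1≤B))
  0≤A′ : + 0 ≤ A - + 2 * B
  0≤A′ = i≤j⇒0≤j-i 2B≤A
  A′<n : + 1 + (A - + 2 * B) ≤ + n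
  A′<n = ≤-via ((+ 1 + + n - (+ 1 + A)) + + 2 * (B - + 1) + + 1) (identity (+ n) A B)
    (nonNeg-+ (nonNeg-+ (i≤j⇒0≤j-i A<1+n) (nonNeg-* (nonNeg-ℕ 2) (i≤j⇒0≤j-i 1≤B))) (nonNeg-ℕ 1))
    where
    identity : ∀ n A B → n - (+ 1 + (A - + 2 * B)) ≡ (+ 1 + n - (+ 1 + A)) + + 2 * (B - + 1) + + 1
    identity = solve-∀
  odd′ : N (A - + 2 * B) B ≈₂ + 1
  odd′ = ≈₂-trans (N[x-2y,y]≈₂N[x,y] A B) odd
  ratio-shifted : Ratio>g (A - + 2 * B) B
  ratio-shifted = odd∧nonNeg⇒pos odd′
    (subst (+ 0 ≤_) (sym (N[x-2y,y]≡-N[y,x-y] A B))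
      (≤-via (+ 1 - (+ 1 + N B (A - B))) (identity (N B (A - B))) (i≤j⇒0≤j-i (≰⇒1+≤ ratio′≰))))
    where
    identity : ∀ m → - m - + 0 ≡ + 1 - (+ 1 + m)
    identity = solve-∀

-- From 𝒮 to 𝒫̃

module Predecessor {A B C D : ℤ} (unimodular : Sign (det (mat A B C D)))
                   (parity : ParityClass (mat A B C D))
                   (1≤D : + 1 ≤ D) (D≤B : D ≤ B) (C≤A : C ≤ A) (step : OddStep A B) where

  open OddStep step public

  d′ : ℤ
  d′ = e * (C - a * D)

  σ′ : Mat
  σ′ = mat B b′ D d′

  1≤B : + 1 ≤ B
  1≤B = ≤-trans 1≤D D≤B

  0≤B : + 0 ≤ B
  0≤B = ≤-trans (nonNeg-ℕ 1) 1≤B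

  e*e≡1 : e * e ≡ + 1
  e*e≡1 = Sign⇒i*i≡1 sign

  C≡aD+ed′ : C ≡ a * D + e * d′
  C≡aD+ed′ = begin
    C                              ≡⟨ identity₀ a D C ⟩
    a * D + + 1 * (C - a * D)      ≡⟨ cong (λ s → a * D + s * (C - a * D)) (sym e*e≡1) ⟩
    a * D + (e * e) * (C - a * D)  ≡⟨ identity₁ a D C e ⟩
    a * D + e * d′                 ∎
    where
    open ≡-Reasoning
    identity₀ : ∀ a D C → C ≡ a * D + + 1 * (C - a * D)
    identity₀ = solve-∀
    identity₁ : ∀ a D C e → a * D + (e * e) * (C - a * D) ≡ a * D + e * (e * (C - a * D))
    identity₁ = solve-∀

  b′≡e[A-aB] : b′ ≡ e * (A - a * B)
  b′≡e[A-aB] = begin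
    b′                        ≡⟨ identity₀ b′ ⟩
    + 1 * b′                  ≡⟨ cong (_* b′) (sym e*e≡1) ⟩
    (e * e) * b′              ≡⟨ identity₁ a B e b′ ⟩
    e * ((a * B + e * b′) - a * B) ≡⟨ cong (λ x → e * (x - a * B)) (sym A≡aB+eb′) ⟩
    e * (A - a * B)           ∎
    where
    open ≡-Reasoning
    identity₀ : ∀ x → x ≡ + 1 * x
    identity₀ = solve-∀
    identity₁ : ∀ a B e b′ → (e * e) * b′ ≡ e * ((a * B + e * b′) - a * B)
    identity₁ = solve-∀

  σ′⊗M≡σ : σ′ ⊗ M a e ≡ mat A B C D
  σ′⊗M≡σ = trans (⊗-M B b′ D d′ a e) (mat-cong (sym A≡aB+eb′) refl (sym C≡aD+ed′) refl)

  det-σ : det (mat A B C D) ≡ det σ′ * - e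
  det-σ = trans (cong det (sym σ′⊗M≡σ)) (trans (det-⊗ σ′ (M a e)) (cong (det σ′ *_) (det-M a e)))

  unimodular′ : Sign (det σ′)
  unimodular′ = Sign[det]-⊗M⁻¹ {σ′} {a} sign (subst (Sign ∘ det) (sym σ′⊗M≡σ) unimodular)

  parity′ : ParityClass σ′
  parity′ = subst (λ x → ParityClass (mat B x D d′)) (sym b′≡e[A-aB])
    (parityClass-⊗M⁻¹ (OddPos⇒odd a-odd) (Sign⇒odd sign) parity)

  B≡1⇒D≡1 : B ≡ + 1 → D ≡ + 1
  B≡1⇒D≡1 B≡1 = ≤-antisym (subst (D ≤_) B≡1 D≤B) 1≤D

  1≤b′ : + 1 ≤ b′
  1≤b′ = nonNeg∧≢0⇒pos 0≤b′ b′≢0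
    where
    b′≢0 : b′ ≢ + 0
    b′≢0 b′≡0 = excluded parity′
      where
      B≡1 : B ≡ + 1
      B≡1 = nonNeg∧Sign[i*j]⇒i≡1 0≤B
        (subst Sign (trans (cong (λ x → B * d′ - x * D) b′≡0) (identity B d′ D)) unimodular′)
        where
        identity : ∀ B d′ D → B * d′ - + 0 * D ≡ B * d′
        identity = solve-∀
      excluded : ParityClass σ′ → ⊥
      excluded (inj₁ (_ , _ , D≈0 , _))       = 1≉₂0 (subst (_≈₂ + 0) (B≡1⇒D≡1 B≡1) D≈0)
      excluded (inj₂ (inj₁ (B≈0 , _)))        = 1≉₂0 (subst (_≈₂ + 0) B≡1 B≈0)
      excluded (inj₂ (inj₂ (_ , b′≈1 , _)))   = 0≉₂1 (subst (_≈₂ + 1) b′≡0 b′≈1)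

  0≤d′ : + 0 ≤ d′
  0≤d′ with + 0 ≤? d′
  ... | yes 0≤d′ = 0≤d′
  ... | no  0≰d′ = ⊥-elim (nonNeg≢-1
    (nonNeg-+ (nonNeg-+ (nonNeg-+ (nonNeg-+ (nonNeg-* 0≤B (i≤j⇒0≤j-i (≰⇒1+≤ 0≰d′)))
                                            (Sign⇒0≤1+i unimodular′))
                                  (nonNeg-* (i≤j⇒0≤j-i 1≤b′) (≤-trans (nonNeg-ℕ 1) 1≤D)))
                        (i≤j⇒0≤j-i 1≤D))
              (i≤j⇒0≤j-i 1≤B))
    (identity B b′ D d′))
    where
    identity : ∀ B b′ D d′ → B * (+ 0 - (+ 1 + d′)) + ((B * d′ - b′ * D) + + 1)
                             + (b′ - + 1) * D + (D - + 1) + (B - + 1) ≡ -[1+ 0 ]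
    identity = solve-∀

  -- Otherwise det σ′ ≥ B forces B = D = det σ′ = 1; then e = −1 contradicts 2b′ ≤ B,
  -- and e = 1 gives det σ = −1, i.e. C = A + 1.
  d′≤b′ : d′ ≤ b′
  d′≤b′ with d′ ≤? b′
  ... | yes d′≤b′ = d′≤b′
  ... | no  d′≰b′ = ⊥-elim (excluded unimodular′)
    where
    B≤det : B ≤ det σ′
    B≤det = ≤-via (B * (d′ - (+ 1 + b′)) + b′ * (B - D)) (identity B b′ D d′)
      (nonNeg-+ (nonNeg-* 0≤B (i≤j⇒0≤j-i (≰⇒1+≤ d′≰b′))) (nonNeg-* 0≤b′ (i≤j⇒0≤j-i D≤B)))
      where
      identity : ∀ B b′ D d′ → (B * d′ - b′ * D) - B ≡ B * (d′ - (+ 1 + b′)) + b′ * (B - D)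
      identity = solve-∀
    excluded : Sign (det σ′) → ⊥
    excluded (inj₂ det≡-1) = nonNeg≢-1
      (nonNeg-+ (nonNeg-+ (i≤j⇒0≤j-i (subst (B ≤_) det≡-1 B≤det)) (i≤j⇒0≤j-i 1≤B)) (nonNeg-ℕ 1))
      (identity B)
      where
      identity : ∀ B → ((-[1+ 0 ] - B) + (B - + 1)) + + 1 ≡ -[1+ 0 ]
      identity = solve-∀
    excluded (inj₁ det≡1) = excluded-sign sign
      where
      B≡1 : B ≡ + 1
      B≡1 = ≤-antisym (subst (B ≤_) det≡1 B≤det) 1≤B
      excluded-sign : Sign e → ⊥
      excluded-sign (inj₂ e≡-1) with ratio-large e≡-1
      ... | 2b′≤B , _ = nonNeg≢-1
        (nonNeg-+ (i≤j⇒0≤j-i 2b′≤B) (nonNeg-* (nonNeg-ℕ 2) (i≤j⇒0≤j-i 1≤b′)))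
        (trans (cong (λ x → (x - + 2 * b′) + + 2 * (b′ - + 1)) B≡1) (identity b′))
        where
        identity : ∀ b′ → (+ 1 - + 2 * b′) + + 2 * (b′ - + 1) ≡ -[1+ 0 ]
        identity = solve-∀
      excluded-sign (inj₁ e≡1) = nonNeg≢-1 (i≤j⇒0≤j-i C≤A) A-C≡-1
        where
        open ≡-Reasoning
        identity : ∀ A C → A - C ≡ A * + 1 - + 1 * C
        identity = solve-∀
        A-C≡-1 : A - C ≡ -[1+ 0 ]
        A-C≡-1 = begin
          A - C              ≡⟨ identity A C ⟩
          A * + 1 - + 1 * C  ≡⟨ cong₂ (λ d b → A * d - b * C) (sym (B≡1⇒D≡1 B≡1)) (sym B≡1) ⟩
          A * D - B * C      ≡⟨ det-σ ⟩
          det σ′ * - e       ≡⟨ cong₂ (λ x y → x * - y) det≡1 e≡1 ⟩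
          -[1+ 0 ]           ∎

  σ′∈S : InS σ′
  σ′∈S = (unimodular′ , ParityClass⇒congruent σ′ parity′) , 0≤d′ , d′≤b′ , 1≤D , D≤B ,
         Ratio>g⇒GtG B b′ ratio

record Expansion (σ : Mat) : Set where
  constructor expansion
  field
    last       : ℤ
    admissible : Admissible σ last
    last-large : Ratio>2+g (m11 σ) (m12 σ) → + 3 ≤ last

Expansion-M : ∀ {A} → OddPos A → Expansion (M A (+ 1))
Expansion-M {A} A-odd = expansion A (single A-odd) (λ (2≤A , _) → OddPos∧2≤⇒3≤ A-odd 2≤A)

InS⇒Expansion-D≡0 : ∀ {A B C} → InS (mat A B C (+ 0)) → Expansion (mat A B C (+ 0))
InS⇒Expansion-D≡0 {A} {B} {C} ((unimodular , congruent) , 0≤D , D≤B , 1≤C , C≤A , _) =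
  subst Expansion (mat-cong refl (sym B≡1) (sym C≡1) refl) (Expansion-M A-odd)
  where
  0≤B = ≤-trans 0≤D D≤B
  0≤C = ≤-trans (nonNeg-ℕ 1) 1≤C
  Sign[BC] : Sign (B * C)
  Sign[BC] = subst Sign (identity A B C) (Sign-neg unimodular)
    where
    identity : ∀ A B C → - (A * + 0 - B * C) ≡ B * C
    identity = solve-∀
  B≡1 : B ≡ + 1
  B≡1 = nonNeg∧Sign[i*j]⇒i≡1 0≤B Sign[BC]
  C≡1 : C ≡ + 1
  C≡1 = nonNeg∧Sign[i*j]⇒i≡1 0≤C (subst Sign (*-comm B C) Sign[BC])
  A-odd : OddPos A
  A-odd with subst₂ (λ b c → ParityClass (mat A b c (+ 0))) B≡1 C≡1
               (congruent⇒ParityClass (mat A B C (+ 0)) congruent)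
  ... | inj₁ (_ , 1≈0 , _)              = ⊥-elim (1≉₂0 1≈0)
  ... | inj₂ (inj₁ (_ , _ , _ , 0≈1))   = ⊥-elim (0≉₂1 0≈1)
  ... | inj₂ (inj₂ (A≈1 , _))           = odd∧nonNeg⇒OddPos A≈1 (≤-trans 0≤C C≤A)

InS⇒Expansion : ∀ n σ → InS σ → + 1 + (m11 σ + m12 σ) ≤ + n → Expansion σ
InS⇒Expansion zero (mat A B C D) (_ , 0≤D , D≤B , 1≤C , C≤A , _) A+B<0 = ⊥-elim (nonNeg≢-1
  (nonNeg-+ (nonNeg-+ (i≤j⇒0≤j-i A+B<0) (≤-trans (nonNeg-ℕ 1) (≤-trans 1≤C C≤A))) (≤-trans 0≤D D≤B))
  (identity A B))
  where
  identity : ∀ A B → ((+ 0 - (+ 1 + (A + B))) + A) + B ≡ -[1+ 0 ]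
  identity = solve-∀
InS⇒Expansion (suc n) (mat A B C (+ zero)) σ∈S _ = InS⇒Expansion-D≡0 σ∈S
InS⇒Expansion (suc n) (mat A B C -[1+ _ ]) (_ , () , _) _
InS⇒Expansion (suc n) (mat A B C (+ suc m)) ((unimodular , congruent) , _ , D≤B , 1≤C , C≤A , gtg)
  A+B<1+n = extend (oddStep (suc ∣ A ∣) A<1+∣A∣ 0≤A (≤-trans 1≤D D≤B) (GtG⇒Ratio>g A B gtg) (N-odd parity))
  where
  parity = congruent⇒ParityClass (mat A B C (+ suc m)) congruent
  1≤D : + 1 ≤ + suc m
  1≤D = +≤+ (ℕ.s≤s ℕ.z≤n)
  0≤A = ≤-trans (nonNeg-ℕ 1) (≤-trans 1≤C C≤A)
  A<1+∣A∣ : + 1 + A ≤ + suc ∣ A ∣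
  A<1+∣A∣ = ≤-reflexive (cong (λ x → + 1 + x) (sym (0≤i⇒+∣i∣≡i 0≤A)))
  extend : OddStep A B → Expansion (mat A B C (+ suc m))
  extend step =
    expansion a (subst (λ τ → Admissible τ a) σ′⊗M≡σ (snoc admissible a-odd sign 2≤last+e)) a-large
    where
    open Predecessor unimodular parity 1≤D D≤B C≤A step
    B+b′<n : + 1 + (B + b′) ≤ + n
    B+b′<n = ≤-via ((+ 1 + + n - (+ 1 + (A + B))) + (A - (+ 1 + b′))) (identity (+ n) A B b′)
      (nonNeg-+ (i≤j⇒0≤j-i A+B<1+n) (i≤j⇒0≤j-i b′<A))
      where
      identity : ∀ n A B b′ → n - (+ 1 + (B + b′)) ≡ (+ 1 + n - (+ 1 + (A + B))) + (A - (+ 1 + b′))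
      identity = solve-∀
    open Expansion (InS⇒Expansion n σ′ σ′∈S B+b′<n)
    2≤last+e : + 2 ≤ last + e
    2≤last+e = digit-admissible (Admissible⇒OddPos admissible) sign (last-large ∘ ratio-large)

InS⇒InP : ∀ σ → InS σ → InP σ
InS⇒InP σ@(mat A B C D) σ∈S@(_ , 0≤D , D≤B , 1≤C , C≤A , _) =
  Admissible⇒InP (Expansion.admissible (InS⇒Expansion (suc ∣ A + B ∣) σ σ∈S
    (≤-reflexive (cong (λ x → + 1 + x) (sym (0≤i⇒+∣i∣≡i 0≤A+B))))))
  where
  0≤A+B = nonNeg-+ (≤-trans (nonNeg-ℕ 1) (≤-trans 1≤C C≤A)) (≤-trans 0≤D D≤B)

lemma11 : (σ : Mat) → InP σ ⇔ InS σ
lemma11 σ = mk⇔ (InP⇒InS σ) (InS⇒InP σ)
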